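{- Every configuration matching template (B2) is reducible. Here a configuration $(C,X,\operatorname{ex})$ matches template (B2) if $C$ consists of a triangle $vwr$ with $\operatorname{ex}(r)=\infty$, $\operatorname{ex}(w)=1$, $\operatorname{ex}(v)=0$, a vertex $u$ adjacent to $v$ with $\operatorname{ex}(u)=2$, an extra-special $uv$-path $P_1$, and a special $vw$-path $P_2$, where $u,v,w\in X$.
   Context: A configuration is a triple $(C,X,\operatorname{ex})$ where $C$ is a plane graph, $X\subseteq V(C)$, and $\operatorname{ex}:V(C)\to\{0,1,2,\infty\}$ (external degree). Its list-size function is $f(v)=4-\operatorname{ex}(v)$ for $v\in X$ and $f(v)=1$ for $v\notin X$ (in particular a vertex with external degree $\infty$ has list size $1$). An $(f,2)$-list-assignment of $C$ is a list assignment $L$ with $|L(v)|\ge f(v)$ for all $v$, $|L(u)\cap L(v)|\le 2$ for every edge $uv$, and $L(u)\cap L(v)=\emptyset$ for every edge $uv$ with $f(u)=f(v)=1$; the configuration is reducible if $C$ has a proper coloring from $L$ for every $(f,2)$-list-assignment $L$. For $u,v\in X$, a special $uv$-path is a $uv$-path in $C$ all of whose internal vertices lie in $X$, have degree $2$ in $C$ and external degree $2$. An extra-special $uv$-path is a $uv$-path in $C$ all of whose internal vertices lie in $X$ and have external degree $2$ and degree $2$ in $C$, except for one consecutive pair $x,y$ of internal vertices with $\operatorname{ex}(x)=\operatorname{ex}(y)=1$ and $d_C(x)=d_C(y)=3$, where there is a vertex $z\notin X$ of $C$ adjacent to both $x$ and $y$ and to no other vertex of $C$. -}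

module Defs where

open import Data.Nat using (ℕ; _≤_)
open import Data.Bool using (Bool; true; false; T; if_then_else_)
open import Data.Bool.Properties using (T?)
open import Data.Fin using (Fin)
open import Data.List using (List; []; _∷_; _++_; length; filter; allFin)
open import Data.List.Membership.Propositional using (_∈_)
open import Data.List.Membership.DecPropositional (Data.Nat._≟_) using (_∈?_)
open import Data.List.Relation.Unary.All using (All)
open import Data.List.Relation.Unary.Unique.Propositional using (Unique)
open import Data.List.Relation.Unary.Linked using (Linked)
open import Data.Product using (Σ; _×_; ∃; ∃-syntax)
open import Data.Sum using (_⊎_)
open import Data.Empty using (⊥)
open import Relation.Nullary using (¬_)
open import Relation.Binary.PropositionalEquality using (_≡_; _≢_)
import Data.Nat

record Graph : Set where
  field
    n     : ℕ
    adj   : Fin n → Fin n → Bool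
    sym   : ∀ i j → adj i j ≡ adj j i
    loopless : ∀ i → adj i i ≡ false

  V : Set
  V = Fin n

  Adj : V → V → Set
  Adj i j = T (adj i j)

  deg : V → ℕ
  deg i = length (filter (λ j → T? (adj i j)) (allFin n))

data ExDeg : Set where
  ex0 ex1 ex2 exInf : ExDeg

record Configuration : Set where
  field
    C  : Graph
  open Graph C public
  field
    inX : V → Bool
    ex  : V → ExDeg

  InX : V → Set
  InX v = T (inX v)

  -- list-size function: f(v) = 4 - ex(v) for v ∈ X (with 4 - ∞ read as 1), f(v) = 1 otherwise
  f : V → ℕ
  f v = if inX v then size (ex v) else 1
    where
    size : ExDeg → ℕ
    size ex0   = 4
    size ex1   = 3
    size ex2   = 2
    size exInf = 1

interSize : List ℕ → List ℕ → ℕ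
interSize A B = length (filter (λ c → c ∈? B) A)

module _ (K : Configuration) where
  open Configuration K

  record IsF2Assignment (L : V → List ℕ) : Set where
    field
      unique   : ∀ v → Unique (L v)
      big      : ∀ v → f v ≤ length (L v)
      smallMeet : ∀ u v → Adj u v → interSize (L u) (L v) ≤ 2
      disjoint : ∀ u v → Adj u v → f u ≡ 1 → f v ≡ 1 → ∀ c → c ∈ L u → c ∈ L v → ⊥

  IsLColouring : (L : V → List ℕ) → (V → ℕ) → Set
  IsLColouring L φ = (∀ v → φ v ∈ L v) × (∀ u v → Adj u v → φ u ≢ φ v)

  Reducible : Set
  Reducible = ∀ (L : V → List ℕ) → IsF2Assignment L → ∃[ φ ] IsLColouring L φ

  pathSeq : V → List V → V → List V
  pathSeq u is v = u ∷ (is ++ (v ∷ []))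

  IsPath : V → List V → V → Set
  IsPath u is v = Unique (pathSeq u is v) × Linked Adj (pathSeq u is v)

  Deg2Ex2 : V → Set
  Deg2Ex2 x = InX x × deg x ≡ 2 × ex x ≡ ex2

  IsSpecialPath : V → List V → V → Set
  IsSpecialPath u is v = InX u × InX v × IsPath u is v × All Deg2Ex2 is

  IsExtraSpecialPath : V → List V → V → V → List V → V → V → Set
  IsExtraSpecialPath u as x y bs z v =
    InX u × InX v × IsPath u (as ++ (x ∷ y ∷ bs)) v × All Deg2Ex2 (as ++ bs)
    × (InX x × ex x ≡ ex1 × deg x ≡ 3)
    × (InX y × ex y ≡ ex1 × deg y ≡ 3)
    × (¬ InX z × Adj z x × Adj z y × (∀ t → Adj z t → t ≡ x ⊎ t ≡ y))

  SameEdge : V → V → V → V → Set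
  SameEdge a b c d = (a ≡ c × b ≡ d) ⊎ (a ≡ d × b ≡ c)

  EdgeOfSeq : V → V → List V → Set
  EdgeOfSeq a b ps = ∃[ pre ] ∃[ post ] ((ps ≡ pre ++ (a ∷ b ∷ post)) ⊎ (ps ≡ pre ++ (b ∷ a ∷ post)))

  MatchesB2With : (u v w r : V) (as : List V) (x y : V) (bs : List V) (z : V) (cs : List V) → Set
  MatchesB2With u v w r as x y bs z cs =
      (InX u × InX v × InX w)
    × (Adj v w × Adj w r × Adj v r)
    × (ex r ≡ exInf × ex w ≡ ex1 × ex v ≡ ex0 × ex u ≡ ex2)
    × Adj u v
    × IsExtraSpecialPath u as x y bs z v
    × IsSpecialPath v cs w
    × (∀ t → t ∈ (u ∷ v ∷ w ∷ r ∷ z ∷ ((as ++ (x ∷ y ∷ bs)) ++ cs)))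
    × (∀ a b → Adj a b →
          SameEdge a b v w ⊎ SameEdge a b w r ⊎ SameEdge a b v r ⊎ SameEdge a b u v
        ⊎ EdgeOfSeq a b (pathSeq u (as ++ (x ∷ y ∷ bs)) v)
        ⊎ SameEdge a b z x ⊎ SameEdge a b z y
        ⊎ EdgeOfSeq a b (pathSeq v cs w))

  MatchesB2 : Set
  MatchesB2 = ∃[ u ] ∃[ v ] ∃[ w ] ∃[ r ] ∃[ as ] ∃[ x ] ∃[ y ] ∃[ bs ] ∃[ z ] ∃[ cs ]
                MatchesB2With u v w r as x y bs z cs

-- Give r and z a colour cr, cz from their one-element lists. Then w keeps two colours besides cr,
-- x and y keep two colours besides cz, and every other vertex of P₁ and P₂ has two colours.
-- v has two candidate colours c, c' (differing from cr, and leaving w two colours); P₂ is then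
-- coloured greedily from v to w. Seen from v, P₁ consists of two arcs ending in x and in y.
-- For an arc of vertices with two available colours hanging off a vertex coloured c or c',
-- either one of the two choices leaves two possible colours for the end of the arc, or each
-- choice forces the end colour and the end vertex allows exactly these two colours. If both
-- arcs were forced, with the same pair of end colours t, s, then L x = L y = {t, s, cz},
-- contradicting |L x ∩ L y| ≤ 2; hence x and y can be given different colours.
-- The two paths are disjoint since the inner vertices of P₂ have degree 2, and w is off P₁
-- because x and y have degree 3 while w would have four neighbours.
module Submission where

open import Defs
open import Data.Nat using (ℕ; _≤_; _+_; z≤n; s≤s; suc)
open import Data.Nat.Properties using (_≟_; ≤-trans; n≮n; n≤1+n; +-suc; +-cancelˡ-≤; +-monoˡ-≤)
open import Data.Bool using (true; false; T)
open import Data.Bool.Properties using (T?)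
open import Data.Fin using (Fin)
open import Data.Fin.Properties using () renaming (_≟_ to _≟F_)
open import Data.List using (List; []; _∷_; _++_; _∷ʳ_; length; filter; allFin; reverse)
open import Data.List.Properties
  using (length-++; filter-notAll; ++-assoc; unfold-reverse; reverse-++; reverse-involutive; map-cong-local)
open import Data.List.Membership.Propositional using (_∈_; _∉_)
open import Data.List.Membership.Propositional.Properties
  using (∈-++⁺ˡ; ∈-++⁺ʳ; ∈-++⁻; ∈-∃++; ∈-filter⁺; ∈-filter⁻; ∈-allFin)
open import Data.List.Membership.DecPropositional _≟_ using (_∈?_)
import Data.List.Membership.DecPropositional as DecMembership
open import Data.List.Relation.Binary.Subset.Propositional using (_⊆_)
open import Data.List.Relation.Binary.Disjoint.Propositional using (Disjoint)
open import Data.List.Relation.Unary.Any using (here; there)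
import Data.List.Relation.Unary.Any as Any
import Data.List.Relation.Unary.Any.Properties as Any
open import Data.List.Relation.Unary.All as All using (All; []; _∷_)
open import Data.List.Relation.Unary.AllPairs as AllPairs using ([]; _∷_)
open import Data.List.Relation.Unary.Linked as Linked using (Linked; []; [-]; _∷_)
import Data.List.Relation.Unary.Linked.Properties as Linkedₚ
open import Data.List.Relation.Unary.Unique.Propositional using (Unique)
import Data.List.Relation.Unary.Unique.Propositional.Properties as Unique
open import Data.Vec.Functional using (updateAt)
open import Data.Vec.Functional.Properties using (updateAt-updates; updateAt-minimal)
open import Data.Product using (∃-syntax; _×_; _,_; proj₁; proj₂)
open import Data.Sum as Sum using (_⊎_; inj₁; inj₂)
open import Data.Empty using (⊥; ⊥-elim)
open import Function using (_∘_; _on_; const)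
open import Relation.Nullary using (¬_; yes; no; contradiction)
open import Relation.Nullary.Decidable using (¬?; _⊎-dec_; _→-dec_)
open import Relation.Unary using (Decidable)
open import Relation.Binary.Definitions using (Symmetric)
open import Relation.Binary.PropositionalEquality using (_≡_; _≢_; refl; sym; trans; subst; cong; ≢-sym)
open import Relation.Binary.PropositionalEquality.Properties using (module ≡-Reasoning)
open ≡-Reasoning

Two : ∀ {A : Set} → (A → Set) → Set
Two P = ∃[ a ] ∃[ b ] a ≢ b × P a × P b

Two-map : ∀ {A : Set} {P P' : A → Set} → (∀ {m} → P m → P' m) → Two P → Two P'
Two-map f (a , b , a≢b , pa , pb) = a , b , a≢b , f pa , f pb

module _ {A : Set} where

  Unique⇒length≤ : ∀ {xs ys : List A} → Unique xs → xs ⊆ ys → length xs ≤ length ys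
  Unique⇒length≤ {[]} _ _ = z≤n
  Unique⇒length≤ {x ∷ xs} (x∉xs ∷ uniq) xs⊆ys with ∈-∃++ (xs⊆ys (here refl))
  ... | pre , post , refl = subst (suc (length xs) ≤_) (sym length-pre-x-post)
                              (s≤s (Unique⇒length≤ uniq xs⊆pre++post))
    where
    xs⊆pre++post : xs ⊆ pre ++ post
    xs⊆pre++post m with ∈-++⁻ pre (xs⊆ys (there m))
    ... | inj₁ m-pre = ∈-++⁺ˡ m-pre
    ... | inj₂ (here refl) = ⊥-elim (All.lookup x∉xs m refl)
    ... | inj₂ (there m-post) = ∈-++⁺ʳ pre m-post
    length-pre-x-post : length (pre ++ x ∷ post) ≡ suc (length (pre ++ post))
    length-pre-x-post = trans (length-++ pre) (trans (+-suc (length pre) (length post)) (cong suc (sym (length-++ pre))))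

module _ {P : ℕ → Set} (P? : Decidable P) where

  length-filter-split : ∀ xs → length (filter P? xs) + length (filter (¬? ∘ P?) xs) ≡ length xs
  length-filter-split [] = refl
  length-filter-split (a ∷ xs) with P? a
  ... | yes _ = cong suc (length-filter-split xs)
  ... | no _ = trans (+-suc _ _) (cong suc (length-filter-split xs))

escapes-or-within : ∀ {P : ℕ → Set} → Decidable P → ∀ (xs : List ℕ) c c' →
  (∃[ m ] m ∈ xs × P m × m ≢ c × m ≢ c') ⊎ (∀ m → m ∈ xs → P m → m ≡ c ⊎ m ≡ c')
escapes-or-within P? [] c c' = inj₂ λ _ ()
escapes-or-within P? (a ∷ xs) c c' with escapes-or-within P? xs c c'
... | inj₁ (m , m∈ , pm , m≢c , m≢c') = inj₁ (m , there m∈ , pm , m≢c , m≢c')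
... | inj₂ within with P? a | a ≟ c | a ≟ c'
...   | no ¬pa | _ | _ = inj₂ λ { m (here refl) pm → contradiction pm ¬pa ; m (there m∈) → within m m∈ }
...   | yes _ | yes a≡c | _ = inj₂ λ { m (here refl) _ → inj₁ a≡c ; m (there m∈) → within m m∈ }
...   | yes _ | no _ | yes a≡c' = inj₂ λ { m (here refl) _ → inj₂ a≡c' ; m (there m∈) → within m m∈ }
...   | yes pa | no a≢c | no a≢c' = inj₁ (a , here refl , pa , a≢c , a≢c')

interSize≤length : ∀ {xs} ys → Unique xs → interSize xs ys ≤ length ys
interSize≤length {xs} ys uniq = Unique⇒length≤ (Unique.filter⁺ (_∈? ys) uniq) (λ m → proj₂ (∈-filter⁻ (_∈? ys) {xs = xs} m))

two-elements : ∀ {A : Set} {zs : List A} → Unique zs → 2 ≤ length zs → Two (_∈ zs)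
two-elements {zs = _ ∷ []} _ (s≤s ())
two-elements {zs = a ∷ b ∷ _} ((a≢b ∷ _) ∷ _) _ = a , b , a≢b , here refl , there (here refl)

two-outside : ∀ {xs} ys → Unique xs → interSize xs ys + 2 ≤ length xs → Two (λ a → a ∈ xs × a ∉ ys)
two-outside {xs} ys uniq bound =
  Two-map (∈-filter⁻ (¬? ∘ (_∈? ys))) (two-elements (Unique.filter⁺ (¬? ∘ (_∈? ys)) uniq) two-outside-long)
  where
  two-outside-long : 2 ≤ length (filter (¬? ∘ (_∈? ys)) xs)
  two-outside-long = +-cancelˡ-≤ (interSize xs ys) _ _
    (subst (interSize xs ys + 2 ≤_) (sym (length-filter-split (_∈? ys) xs)) bound)

⊆-pigeonhole : ∀ {xs ys : List ℕ} → Unique xs → xs ⊆ ys → length ys ≤ length xs → ys ⊆ xs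
⊆-pigeonhole {xs} {ys} uniq xs⊆ys short {b} b∈ys with b ∈? xs
... | yes b∈xs = b∈xs
... | no b∉xs = contradiction (≤-trans shorter (≤-trans short (Unique⇒length≤ uniq xs⊆ys-b))) (n≮n _)
  where
  ≢b? = λ m → ¬? (m ≟ b)
  xs⊆ys-b : xs ⊆ filter ≢b? ys
  xs⊆ys-b {m} m∈xs = ∈-filter⁺ ≢b? (xs⊆ys m∈xs) λ { refl → b∉xs m∈xs }
  shorter : suc (length (filter ≢b? ys)) ≤ length ys
  shorter = filter-notAll ≢b? ys (Any.map (λ { refl b≢b → b≢b refl }) b∈ys)

module _ {A : Set} {R : A → A → Set} where

  Linked-join : ∀ xs {a b : A} {ys} → Linked R (xs ∷ʳ a) → R a b → Linked R (b ∷ ys) → Linked R (xs ++ a ∷ b ∷ ys)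
  Linked-join [] _ ab b-ys = ab ∷ b-ys
  Linked-join (_ ∷ []) (r ∷ [-]) ab b-ys = r ∷ ab ∷ b-ys
  Linked-join (_ ∷ q ∷ xs) (r ∷ rest) ab b-ys = r ∷ Linked-join (q ∷ xs) rest ab b-ys

  Linked-edge : ∀ pre {a b : A} {post} → Linked R (pre ++ a ∷ b ∷ post) → R a b
  Linked-edge [] (ab ∷ _) = ab
  Linked-edge (_ ∷ pre) linked = Linked-edge pre (Linked.tail linked)

  Linked-reverse : Symmetric R → ∀ {xs} → Linked R xs → Linked R (reverse xs)
  Linked-reverse sym-R [] = []
  Linked-reverse sym-R [-] = [-]
  Linked-reverse sym-R {x ∷ y ∷ ys} (xy ∷ rest) = subst (Linked R) reverse-x∷y∷ys
    (Linked-join (reverse ys) (subst (Linked R) (unfold-reverse y ys) (Linked-reverse sym-R rest)) (sym-R xy) [-])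
    where
    reverse-x∷y∷ys : reverse ys ++ y ∷ x ∷ [] ≡ reverse (x ∷ y ∷ ys)
    reverse-x∷y∷ys = begin
      reverse ys ++ y ∷ x ∷ []      ≡⟨ ++-assoc (reverse ys) (y ∷ []) (x ∷ []) ⟨
      (reverse ys ∷ʳ y) ∷ʳ x        ≡⟨ cong (_∷ʳ x) (unfold-reverse y ys) ⟨
      reverse (y ∷ ys) ∷ʳ x         ≡⟨ unfold-reverse x (y ∷ ys) ⟨
      reverse (x ∷ y ∷ ys)          ∎

Linked-≗ : ∀ {A : Set} {f g : A → ℕ} {xs} → All (λ q → f q ≡ g q) xs → Linked (_≢_ on f) xs → Linked (_≢_ on g) xs
Linked-≗ f≗g = Linkedₚ.map⁻ ∘ subst (Linked _≢_) (map-cong-local f≗g) ∘ Linkedₚ.map⁺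

Unique-++⁻ : ∀ {A : Set} (xs : List A) {ys} → Unique (xs ++ ys) → Unique xs × Unique ys × Disjoint xs ys
Unique-++⁻ [] uniq = [] , uniq , λ ()
Unique-++⁻ (x ∷ xs) (x∉ ∷ uniq) with Unique-++⁻ xs uniq
... | uniq-xs , uniq-ys , disjoint =
  All.tabulate (λ m → All.lookup x∉ (∈-++⁺ˡ m)) ∷ uniq-xs , uniq-ys ,
  λ { (here refl , m) → All.lookup x∉ (∈-++⁺ʳ xs m) refl ; (there m , m') → disjoint (m , m') }

Unique-reverse : ∀ {A : Set} {xs : List A} → Unique xs → Unique (reverse xs)
Unique-reverse {xs = []} [] = []
Unique-reverse {xs = x ∷ xs} (x∉ ∷ uniq) = subst Unique (sym (unfold-reverse x xs))
  (Unique.++⁺ (Unique-reverse uniq) ([] ∷ []) λ { (m , here refl) → All.lookup x∉ (Any.reverse⁻ m) refl })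

module _ {A : Set} {R : A → A → Set} where

  first-inside : ∀ {p} ms {q t} → t ∈ ms → Linked R (p ∷ ms ++ q) → ∃[ h ] h ∈ ms × R p h
  first-inside (h ∷ _) _ (ph ∷ _) = h , here refl , ph

  inner-neighbours : ∀ p ms q {t} → Unique (p ∷ ms ∷ʳ q) → Linked R (p ∷ ms ∷ʳ q) → t ∈ ms →
    ∃[ a ] ∃[ b ] a ≢ b × a ∈ p ∷ ms ∷ʳ q × b ∈ p ∷ ms ∷ʳ q × R a t × R t b
  inner-neighbours p (m ∷ []) q ((_ ∷ p≢q ∷ []) ∷ _) (pm ∷ mq ∷ [-]) (here refl) =
    p , q , p≢q , here refl , there (there (here refl)) , pm , mq
  inner-neighbours p (m ∷ m' ∷ ms) q ((_ ∷ p≢m' ∷ _) ∷ _) (pm ∷ mm' ∷ _) (here refl) =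
    p , m' , p≢m' , here refl , there (there (here refl)) , pm , mm'
  inner-neighbours p (m ∷ ms) q (_ ∷ uniq) (_ ∷ rest) (there t∈) with inner-neighbours m ms q uniq rest t∈
  ... | a , b , a≢b , a∈ , b∈ , at , tb = a , b , a≢b , there a∈ , there b∈ , at , tb

pick-avoiding : ∀ {P : ℕ → Set} → Two P → ∀ f → ∃[ d ] P d × d ≢ f
pick-avoiding (a , b , a≢b , pa , pb) f with a ≟ f
... | yes refl = b , pb , ≢-sym a≢b
... | no a≢f = a , pa , a≢f

-- If some admissible colour m avoids both c and c', pair m with a second admissible colour.
two-avoiding : ∀ {P : ℕ → Set} {c c'} → Two P → (∃[ m ] P m × m ≢ c × m ≢ c') → c ≢ c' →
  Two (λ d → P d × d ≢ c) ⊎ Two (λ d → P d × d ≢ c')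
two-avoiding {c = c} two (m , pm , m≢c , m≢c') c≢c' with pick-avoiding two m
... | k , pk , k≢m with k ≟ c
...   | yes refl = inj₂ (k , m , k≢m , (pk , c≢c') , (pm , m≢c'))
...   | no k≢c = inj₁ (k , m , k≢m , (pk , k≢c) , (pm , m≢c))

exactly-pair : ∀ {P : ℕ → Set} {c c'} → Two P → (∀ m → P m → m ≡ c ⊎ m ≡ c') → P c × P c'
exactly-pair (a , b , a≢b , pa , pb) within with within a pa | within b pb
... | inj₁ refl | inj₁ refl = ⊥-elim (a≢b refl)
... | inj₁ refl | inj₂ refl = pa , pb
... | inj₂ refl | inj₁ refl = pb , pa
... | inj₂ refl | inj₂ refl = ⊥-elim (a≢b refl)

module PathColouring {V : Set} (Allowed : V → ℕ → Set) where

  -- Extends e ps t: the path ps, attached to a vertex of colour e, can be coloured ending in colour t.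
  data Extends : ℕ → List V → ℕ → Set where
    []  : ∀ {e} → Extends e [] e
    _∷_ : ∀ {e p ps c t} → Allowed p c × c ≢ e → Extends c ps t → Extends e (p ∷ ps) t

  TwoAllowed : V → Set
  TwoAllowed p = Two (Allowed p)

  greedy : ∀ {ps} → All TwoAllowed ps → ∀ e → ∃[ t ] Extends e ps t
  greedy [] e = e , []
  greedy (two-p ∷ two-ps) e with pick-avoiding two-p e
  ... | c , allowed , c≢e with greedy two-ps c
  ...   | t , rest = t , (allowed , c≢e) ∷ rest

  Within : V → ℕ → ℕ → Set
  Within p c c' = ∀ m → Allowed p m → m ≡ c ⊎ m ≡ c'

  Escapes : V → ℕ → ℕ → Set
  Escapes p c c' = ∃[ m ] Allowed p m × m ≢ c × m ≢ c'

  Separated : ℕ → ℕ → List V → Set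
  Separated c c' ps = ∃[ t ] ∃[ s ] t ≢ s × Extends c ps t × Extends c' ps s

  AllowsExactly : V → ℕ → ℕ → Set
  AllowsExactly z t s = Allowed z t × Allowed z s × Within z t s

  Forced : ℕ → ℕ → List V → V → Set
  Forced c c' ps z = ∃[ t ] ∃[ s ] t ≢ s × Extends c (ps ∷ʳ z) t × Extends c' (ps ∷ʳ z) s × AllowsExactly z t s

  Outcome : ℕ → ℕ → List V → Set → Set
  Outcome c c' ps Otherwise = Two (Extends c ps) ⊎ Two (Extends c' ps) ⊎ Otherwise

  prefix : ∀ {p ps c e} → Allowed p c × c ≢ e → Two (Extends c ps) → Two (Extends e (p ∷ ps))
  prefix first (t , t' , t≢t' , et , et') = t , t' , t≢t' , first ∷ et , first ∷ et'

  extend-twice : ∀ {p ps e} → Two (λ d → Allowed p d × d ≢ e) →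
    (∀ {d d'} → d ≢ d' → Outcome d d' ps (Separated d d' ps)) → Two (Extends e (p ∷ ps))
  extend-twice (d , d' , d≢d' , first , second) rest with rest d≢d'
  ... | inj₁ two = prefix first two
  ... | inj₂ (inj₁ two) = prefix second two
  ... | inj₂ (inj₂ (t , t' , t≢t' , et , et')) = t , t' , t≢t' , first ∷ et , second ∷ et'

  escape : ∀ {p ps c c' Otherwise} → TwoAllowed p → Escapes p c c' → c ≢ c' →
    (∀ {d d'} → d ≢ d' → Outcome d d' ps (Separated d d' ps)) → Outcome c c' (p ∷ ps) Otherwise
  escape two escapes c≢c' rest =
    Sum.[ (λ avoid-c → inj₁ (extend-twice avoid-c rest)) , (λ avoid-c' → inj₂ (inj₁ (extend-twice avoid-c' rest))) ]′
      (two-avoiding two escapes c≢c')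

  -- If the first vertex allows a colour outside {c, c'}, one of the two choices leaves it two
  -- colours; otherwise it allows exactly c and c', and the rest of the path sees c and c' swapped.
  dichotomy : (∀ p c c' → Escapes p c c' ⊎ Within p c c') →
    ∀ ps {z} → All TwoAllowed (ps ∷ʳ z) → ∀ {c c'} → c ≢ c' → Outcome c c' (ps ∷ʳ z) (Forced c c' ps z)
  dichotomy split [] {z} (two-z ∷ []) {c} {c'} c≢c' with split z c c'
  ... | inj₁ escapes = escape two-z escapes c≢c' λ d≢d' → inj₂ (inj₂ (_ , _ , d≢d' , [] , []))
  ... | inj₂ within with exactly-pair two-z within
  ...   | ac , ac' = inj₂ (inj₂ (c' , c , ≢-sym c≢c' , (ac' , ≢-sym c≢c') ∷ [] , (ac , c≢c') ∷ [] ,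
                                  ac' , ac , λ m am → Sum.swap (within m am)))
  dichotomy split (p ∷ qs) (two-p ∷ two-rest) {c} {c'} c≢c' with split p c c'
  ... | inj₁ escapes = escape two-p escapes c≢c' λ d≢d' →
          Sum.map₂ (Sum.map₂ λ (t , s , t≢s , et , es , _) → t , s , t≢s , et , es) (dichotomy split qs two-rest d≢d')
  ... | inj₂ within with exactly-pair two-p within | dichotomy split qs two-rest (≢-sym c≢c')
  ...   | ac , ac' | inj₁ two = inj₁ (prefix (ac' , ≢-sym c≢c') two)
  ...   | ac , ac' | inj₂ (inj₁ two) = inj₂ (inj₁ (prefix (ac , c≢c') two))
  ...   | ac , ac' | inj₂ (inj₂ (t , s , t≢s , et , es , exact)) =
          inj₂ (inj₂ (t , s , t≢s , (ac' , ≢-sym c≢c') ∷ et , (ac , c≢c') ∷ es , exact))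

lastOf : ∀ {V : Set} → V → List V → V
lastOf s [] = s
lastOf _ (p ∷ ps) = lastOf p ps

lastOf-∷ʳ : ∀ {V : Set} (s : V) ps z → lastOf s (ps ∷ʳ z) ≡ z
lastOf-∷ʳ s [] z = refl
lastOf-∷ʳ s (p ∷ ps) z = lastOf-∷ʳ p ps z

module Realisation {n : ℕ} (Allowed : Fin n → ℕ → Set) where

  open PathColouring Allowed

  record Realises (γ : Fin n → ℕ) (s : Fin n) (ps : List (Fin n)) (t : ℕ) : Set where
    field
      colouring : Fin n → ℕ
      unchanged : ∀ q → q ∉ ps → colouring q ≡ γ q
      allowed   : All (λ p → Allowed p (colouring p)) ps
      proper    : Linked (_≢_ on colouring) (s ∷ ps)
      ends      : colouring (lastOf s ps) ≡ t

  realise : ∀ {γ s e ps t} → γ s ≡ e → s ∉ ps → Unique ps → Extends e ps t → Realises γ s ps t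
  realise {γ} γs≡e _ _ [] = record { colouring = γ ; unchanged = λ _ _ → refl ; allowed = [] ; proper = [-] ; ends = γs≡e }
  realise {γ} {s} {e} {p ∷ ps} γs≡e s∉ uniq@(_ ∷ uniq-ps) (_∷_ {c = c} (allowed-c , c≢e) rest) = record
    { colouring = colouring
    ; unchanged = λ q q∉ → trans (unchanged q (q∉ ∘ there)) (updateAt-minimal q p γ (q∉ ∘ here))
    ; allowed = subst (Allowed p) (sym colour-p) allowed-c ∷ allowed
    ; proper = (λ eq → c≢e (trans (sym colour-p) (trans (sym eq) colour-s))) ∷ proper
    ; ends = ends
    }
    where
    open Realises (realise {updateAt γ p (const c)} (updateAt-updates p γ) (Unique.Unique[x∷xs]⇒x∉xs uniq) uniq-ps rest)
    colour-p : colouring p ≡ c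
    colour-p = trans (unchanged p (Unique.Unique[x∷xs]⇒x∉xs uniq)) (updateAt-updates p γ)
    colour-s : colouring s ≡ e
    colour-s = trans (unchanged s (s∉ ∘ there)) (trans (updateAt-minimal s p γ (s∉ ∘ here)) γs≡e)

module _ (G : Graph) where
  open Graph G using (V; adj; Adj; deg; n)

  Adj-sym : ∀ {a b} → Adj a b → Adj b a
  Adj-sym {a} {b} = subst T (Graph.sym G a b)

  neighbours≤deg : ∀ t {ys} → Unique ys → All (Adj t) ys → length ys ≤ deg t
  neighbours≤deg t uniq adjacent = Unique⇒length≤ uniq
    (λ m → ∈-filter⁺ (λ j → T? (adj t j)) (∈-allFin _) (All.lookup adjacent m))

capacity : ExDeg → ℕ
capacity ex0 = 4
capacity ex1 = 3
capacity ex2 = 2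
capacity exInf = 1

module _ (K : Configuration) where
  open Configuration K hiding (sym)

  f-inX : ∀ {t} → InX t → f t ≡ capacity (ex t)
  f-inX {t} t∈X with inX t | ex t
  ... | true | ex0 = refl
  ... | true | ex1 = refl
  ... | true | ex2 = refl
  ... | true | exInf = refl

  f-notX : ∀ {t} → ¬ InX t → f t ≡ 1
  f-notX {t} t∉X with inX t
  ... | true = contradiction _ t∉X
  ... | false = refl

  f-exInf : ∀ {t} → ex t ≡ exInf → f t ≡ 1
  f-exInf {t} ex-t with inX t
  ... | true rewrite ex-t = refl
  ... | false = refl

  ex-≢ : ∀ {a b e e'} → ex a ≡ e → ex b ≡ e' → e ≢ e' → a ≢ b
  ex-≢ ex-a ex-b e≢e' refl = e≢e' (trans (sym ex-a) ex-b)

  X-≢ : ∀ {a b} → InX a → ¬ InX b → a ≢ b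
  X-≢ a∈X b∉X refl = b∉X a∈X

  same-edge : ∀ {R : V → V → Set} → Symmetric R → ∀ {a b c d} → SameEdge K a b c d → R c d → R a b
  same-edge _ (inj₁ (refl , refl)) cd = cd
  same-edge sym-R (inj₂ (refl , refl)) cd = sym-R cd

  linked-edge : ∀ {R : V → V → Set} → Symmetric R → ∀ {a b ps} → Linked R ps → EdgeOfSeq K a b ps → R a b
  linked-edge _ linked (pre , _ , inj₁ refl) = Linked-edge pre linked
  linked-edge sym-R linked (pre , _ , inj₂ refl) = sym-R (Linked-edge pre linked)

  record B2 (u v w r : V) (as : List V) (x y : V) (bs : List V) (z : V) (cs : List V) : Set where
    field
      u∈X : InX u
      v∈X : InX v
      w∈X : InX w
      x∈X : InX x
      y∈X : InX y
      z∉X : ¬ InX z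
      ex-r : ex r ≡ exInf
      ex-w : ex w ≡ ex1
      ex-v : ex v ≡ ex0
      ex-u : ex u ≡ ex2
      ex-x : ex x ≡ ex1
      ex-y : ex y ≡ ex1
      deg-x : deg x ≡ 3
      deg-y : deg y ≡ 3
      v-w : Adj v w
      w-r : Adj w r
      v-r : Adj v r
      u-v : Adj u v
      z-x : Adj z x
      z-y : Adj z y
      z-neighbours : ∀ t → Adj z t → t ≡ x ⊎ t ≡ y
      P₁-unique : Unique (pathSeq K u (as ++ x ∷ y ∷ bs) v)
      P₁-path : Linked Adj (pathSeq K u (as ++ x ∷ y ∷ bs) v)
      P₁-inner : All (Deg2Ex2 K) (as ++ bs)
      P₂-unique : Unique (pathSeq K v cs w)
      P₂-path : Linked Adj (pathSeq K v cs w)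
      P₂-inner : All (Deg2Ex2 K) cs
      covers-vertices : ∀ t → t ∈ u ∷ v ∷ w ∷ r ∷ z ∷ ((as ++ x ∷ y ∷ bs) ++ cs)
      covers-edges : ∀ a b → Adj a b →
          SameEdge K a b v w ⊎ SameEdge K a b w r ⊎ SameEdge K a b v r ⊎ SameEdge K a b u v
        ⊎ EdgeOfSeq K a b (pathSeq K u (as ++ x ∷ y ∷ bs) v)
        ⊎ SameEdge K a b z x ⊎ SameEdge K a b z y
        ⊎ EdgeOfSeq K a b (pathSeq K v cs w)

  matches⇒B2 : ∀ {u v w r as x y bs z cs} → MatchesB2With K u v w r as x y bs z cs → B2 u v w r as x y bs z cs
  matches⇒B2 ((u∈X , v∈X , w∈X) , (v-w , w-r , v-r) , (ex-r , ex-w , ex-v , ex-u) , u-v ,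
      (_ , _ , (P₁-unique , P₁-path) , P₁-inner , (x∈X , ex-x , deg-x) , (y∈X , ex-y , deg-y) , (z∉X , z-x , z-y , z-neighbours)) ,
      (_ , _ , (P₂-unique , P₂-path) , P₂-inner) , covers-vertices , covers-edges) = record
    { u∈X = u∈X ; v∈X = v∈X ; w∈X = w∈X ; x∈X = x∈X ; y∈X = y∈X ; z∉X = z∉X
    ; ex-r = ex-r ; ex-w = ex-w ; ex-v = ex-v ; ex-u = ex-u ; ex-x = ex-x ; ex-y = ex-y
    ; deg-x = deg-x ; deg-y = deg-y
    ; v-w = v-w ; w-r = w-r ; v-r = v-r ; u-v = u-v ; z-x = z-x ; z-y = z-y ; z-neighbours = z-neighbours
    ; P₁-unique = P₁-unique ; P₁-path = P₁-path ; P₁-inner = P₁-inner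
    ; P₂-unique = P₂-unique ; P₂-path = P₂-path ; P₂-inner = P₂-inner
    ; covers-vertices = covers-vertices ; covers-edges = covers-edges
    }

  module Template {u v w r as x y bs z cs} (H : B2 u v w r as x y bs z cs) where
    open B2 H
    open DecMembership (_≟F_ {n}) using () renaming (_∈?_ to _∈V?_)

    I₁ : List V
    I₁ = as ++ x ∷ y ∷ bs

    S₁ : List V
    S₁ = pathSeq K u I₁ v

    Q : List V
    Q = cs ∷ʳ w

    x∈I₁ : x ∈ I₁
    x∈I₁ = ∈-++⁺ʳ as (here refl)

    y∈I₁ : y ∈ I₁
    y∈I₁ = ∈-++⁺ʳ as (there (here refl))

    v∉I₁ : v ∉ I₁
    v∉I₁ v∈ = proj₂ (proj₂ (Unique-++⁻ (u ∷ I₁) P₁-unique)) (there v∈ , here refl)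

    x-y : Adj x y
    x-y = Linked-edge (u ∷ as) (subst (Linked Adj) (cong (u ∷_) (++-assoc as (x ∷ y ∷ bs) (v ∷ []))) P₁-path)

    v≢r : v ≢ r
    v≢r = ex-≢ ex-v ex-r λ ()

    v≢z : v ≢ z
    v≢z = X-≢ v∈X z∉X

    y≢v : y ≢ v
    y≢v refl = v∉I₁ y∈I₁

    x≢v : x ≢ v
    x≢v refl = v∉I₁ x∈I₁

    z≢r : z ≢ r
    z≢r refl with z-neighbours v (Adj-sym C v-r)
    ... | inj₁ refl = v∉I₁ x∈I₁
    ... | inj₂ refl = v∉I₁ y∈I₁

    inner-kind : ∀ {t} → t ∈ as ++ bs → InX t × (t ≡ v ⊎ t ≡ x ⊎ t ≡ y ⊎ ex t ≡ ex2)
    inner-kind t∈ with All.lookup P₁-inner t∈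
    ... | t∈X , _ , ex-t = t∈X , inj₂ (inj₂ (inj₂ ex-t))

    S₁-kinds : ∀ {t} → t ∈ S₁ → InX t × (t ≡ v ⊎ t ≡ x ⊎ t ≡ y ⊎ ex t ≡ ex2)
    S₁-kinds (here refl) = u∈X , inj₂ (inj₂ (inj₂ ex-u))
    S₁-kinds (there t∈) with ∈-++⁻ I₁ t∈
    ... | inj₂ (here refl) = v∈X , inj₁ refl
    ... | inj₁ t∈I₁ with ∈-++⁻ as t∈I₁
    ...   | inj₁ t∈as = inner-kind (∈-++⁺ˡ t∈as)
    ...   | inj₂ (here refl) = x∈X , inj₂ (inj₁ refl)
    ...   | inj₂ (there (here refl)) = y∈X , inj₂ (inj₂ (inj₁ refl))
    ...   | inj₂ (there (there t∈bs)) = inner-kind (∈-++⁺ʳ as t∈bs)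

    -- w would be x or y, which has only three neighbours, while z, its path neighbour, v and r are four.
    w∉S₁ : w ∉ S₁
    w∉S₁ w∈ with S₁-kinds w∈
    ... | _ , inj₁ w≡v = ex-≢ ex-w ex-v (λ ()) w≡v
    ... | _ , inj₂ (inj₂ (inj₂ ex-w')) = ex-≢ ex-w ex-w' (λ ()) refl
    ... | _ , inj₂ (inj₁ refl) = n≮n 3 (subst (4 ≤_) deg-x (neighbours≤deg C x
            ((≢-sym (X-≢ y∈X z∉X) ∷ ≢-sym v≢z ∷ z≢r ∷ []) ∷ (y≢v ∷ ex-≢ ex-y ex-r (λ ()) ∷ []) ∷
             (v≢r ∷ []) ∷ [] ∷ [])
            (Adj-sym C z-x ∷ x-y ∷ Adj-sym C v-w ∷ w-r ∷ [])))
    ... | _ , inj₂ (inj₂ (inj₁ refl)) = n≮n 3 (subst (4 ≤_) deg-y (neighbours≤deg C y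
            ((≢-sym (X-≢ x∈X z∉X) ∷ ≢-sym v≢z ∷ z≢r ∷ []) ∷ (x≢v ∷ ex-≢ ex-x ex-r (λ ()) ∷ []) ∷
             (v≢r ∷ []) ∷ [] ∷ [])
            (Adj-sym C z-y ∷ Adj-sym C x-y ∷ Adj-sym C v-w ∷ w-r ∷ [])))

    S₁-neighbours : ∀ {t} → t ∈ S₁ → t ≢ v → ∃[ a ] ∃[ b ] a ≢ b × a ∈ S₁ × b ∈ S₁ × Adj t a × Adj t b
    S₁-neighbours (here refl) _ with first-inside I₁ x∈I₁ P₁-path
    ... | h , h∈ , u-h = v , h , (λ { refl → v∉I₁ h∈ }) , there (∈-++⁺ʳ I₁ (here refl)) , there (∈-++⁺ˡ h∈) , u-v , u-h
    S₁-neighbours (there t∈) t≢v with ∈-++⁻ I₁ t∈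
    ... | inj₂ (here t≡v) = contradiction t≡v t≢v
    ... | inj₁ t∈I₁ with inner-neighbours u I₁ v P₁-unique P₁-path t∈I₁
    ...   | a , b , a≢b , a∈ , b∈ , a-t , t-b = a , b , a≢b , a∈ , b∈ , Adj-sym C a-t , t-b

    -- t already has two neighbours on the cycle S₁ + uv.
    S₁-closed : ∀ {t s} → t ∈ S₁ → t ≢ v → deg t ≡ 2 → Adj t s → s ∈ S₁
    S₁-closed {t} {s} t∈ t≢v deg-t t-s with s ∈V? S₁ | S₁-neighbours t∈ t≢v
    ... | yes s∈ | _ = s∈
    ... | no s∉ | a , b , a≢b , a∈ , b∈ , t-a , t-b = ⊥-elim (n≮n 2 (subst (3 ≤_) deg-t
            (neighbours≤deg C t ((a≢b ∷ (λ { refl → s∉ a∈ }) ∷ []) ∷ ((λ { refl → s∉ b∈ }) ∷ []) ∷ [] ∷ [])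
                                (t-a ∷ t-b ∷ t-s ∷ []))))

    -- Induction along P₂ from the end w, which is off S₁.
    off-S₁ : ∀ ds → Linked Adj (ds ∷ʳ w) → All (Deg2Ex2 K) ds → All (_≢ v) ds → All (_∉ S₁) ds
    off-S₁ [] _ _ _ = []
    off-S₁ (t ∷ []) (t-w ∷ _) ((_ , deg-t , _) ∷ []) (t≢v ∷ []) = (λ t∈ → w∉S₁ (S₁-closed t∈ t≢v deg-t t-w)) ∷ []
    off-S₁ (t ∷ d ∷ ds) (t-d ∷ path) ((_ , deg-t , _) ∷ inner) (t≢v ∷ ≢v) with off-S₁ (d ∷ ds) path inner ≢v
    ... | rest@(d∉ ∷ _) = (λ t∈ → d∉ (S₁-closed t∈ t≢v deg-t t-d)) ∷ rest

    v∉Q : v ∉ Q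
    v∉Q = Unique.Unique[x∷xs]⇒x∉xs P₂-unique

    Q-unique : Unique Q
    Q-unique = AllPairs.tail P₂-unique

    cs≢v : All (_≢ v) cs
    cs≢v = All.tabulate λ t∈cs t≡v → v∉Q (subst (_∈ Q) t≡v (∈-++⁺ˡ t∈cs))

    Q∉S₁ : ∀ {t} → t ∈ Q → t ∉ S₁
    Q∉S₁ t∈ with ∈-++⁻ cs t∈
    ... | inj₁ t∈cs = All.lookup (off-S₁ cs (Linked.tail P₂-path) P₂-inner cs≢v) t∈cs
    ... | inj₂ (here refl) = w∉S₁

    -- P₁ = u … x y … v splits into the arcs A = u … x and Y = y … v; B is Y reversed and without v,
    -- so that both A and B hang off v.
    A : List V
    A = (u ∷ as) ∷ʳ x

    Y : List V
    Y = (y ∷ bs) ∷ʳ v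

    B : List V
    B = reverse bs ∷ʳ y

    S₁≡A++Y : S₁ ≡ A ++ Y
    S₁≡A++Y = cong (u ∷_) (trans (++-assoc as (x ∷ y ∷ bs) (v ∷ [])) (sym (++-assoc as (x ∷ []) Y)))

    A-Y-split : Unique A × Unique Y × Disjoint A Y
    A-Y-split = Unique-++⁻ A (subst Unique S₁≡A++Y P₁-unique)

    A-unique : Unique A
    A-unique = proj₁ A-Y-split

    A-Y-disjoint : Disjoint A Y
    A-Y-disjoint = proj₂ (proj₂ A-Y-split)

    y∷bs-v-split : Unique (y ∷ bs) × Unique (v ∷ []) × Disjoint (y ∷ bs) (v ∷ [])
    y∷bs-v-split = Unique-++⁻ (y ∷ bs) (proj₁ (proj₂ A-Y-split))

    B-unique : Unique B
    B-unique = subst Unique (unfold-reverse y bs) (Unique-reverse (proj₁ y∷bs-v-split))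

    B⊆y∷bs : B ⊆ y ∷ bs
    B⊆y∷bs t∈ with ∈-++⁻ (reverse bs) t∈
    ... | inj₁ t∈bs = there (Any.reverse⁻ t∈bs)
    ... | inj₂ (here refl) = here refl

    A⊆S₁ : A ⊆ S₁
    A⊆S₁ {t} t∈ = subst (t ∈_) (sym S₁≡A++Y) (∈-++⁺ˡ t∈)

    B⊆S₁ : B ⊆ S₁
    B⊆S₁ {t} t∈ = subst (t ∈_) (sym S₁≡A++Y) (∈-++⁺ʳ A (∈-++⁺ˡ (B⊆y∷bs t∈)))

    A-B-disjoint : Disjoint A B
    A-B-disjoint (t∈A , t∈B) = A-Y-disjoint (t∈A , ∈-++⁺ˡ (B⊆y∷bs t∈B))

    B∉A : ∀ {t} → t ∈ B → t ∉ A
    B∉A t∈B t∈A = A-B-disjoint (t∈A , t∈B)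

    Q∉A : ∀ {t} → t ∈ Q → t ∉ A
    Q∉A t∈ = Q∉S₁ t∈ ∘ A⊆S₁

    Q∉B : ∀ {t} → t ∈ Q → t ∉ B
    Q∉B t∈ = Q∉S₁ t∈ ∘ B⊆S₁

    v∉A : v ∉ A
    v∉A v∈ = A-Y-disjoint (v∈ , ∈-++⁺ʳ (y ∷ bs) (here refl))

    v∉B : v ∉ B
    v∉B v∈ = proj₂ (proj₂ y∷bs-v-split) (B⊆y∷bs v∈ , here refl)

    r∉S₁ : r ∉ S₁
    r∉S₁ r∈ with S₁-kinds r∈
    ... | _ , inj₁ r≡v = v≢r (sym r≡v)
    ... | _ , inj₂ (inj₁ refl) = ex-≢ ex-r ex-x (λ ()) refl
    ... | _ , inj₂ (inj₂ (inj₁ refl)) = ex-≢ ex-r ex-y (λ ()) refl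
    ... | _ , inj₂ (inj₂ (inj₂ ex-r')) = ex-≢ ex-r ex-r' (λ ()) refl

    z∉S₁ : z ∉ S₁
    z∉S₁ z∈ = z∉X (proj₁ (S₁-kinds z∈))

    Q-kinds : ∀ {t} → t ∈ Q → InX t × (t ≡ w ⊎ ex t ≡ ex2)
    Q-kinds t∈ with ∈-++⁻ cs t∈
    ... | inj₁ t∈cs = let t∈X , _ , ex-t = All.lookup P₂-inner t∈cs in t∈X , inj₂ ex-t
    ... | inj₂ (here refl) = w∈X , inj₁ refl

    r∉Q : r ∉ Q
    r∉Q r∈ with Q-kinds r∈
    ... | _ , inj₁ refl = ex-≢ ex-r ex-w (λ ()) refl
    ... | _ , inj₂ ex-r' = ex-≢ ex-r ex-r' (λ ()) refl

    z∉Q : z ∉ Q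
    z∉Q z∈ = z∉X (proj₁ (Q-kinds z∈))

    I₁-split : ∀ {t} → t ∈ I₁ → t ∈ A ⊎ t ∈ B
    I₁-split t∈ with ∈-++⁻ as t∈
    ... | inj₁ t∈as = inj₁ (there (∈-++⁺ˡ t∈as))
    ... | inj₂ (here refl) = inj₁ (there (∈-++⁺ʳ as (here refl)))
    ... | inj₂ (there (here refl)) = inj₂ (∈-++⁺ʳ (reverse bs) (here refl))
    ... | inj₂ (there (there t∈bs)) = inj₂ (∈-++⁺ˡ (Any.reverse⁺ t∈bs))

    module Colouring (L : V → List ℕ) (isF : IsF2Assignment K L) where
      open IsF2Assignment isF using (unique; big; smallMeet)

      length-L : ∀ {t e} → InX t → ex t ≡ e → capacity e ≤ length (L t)
      length-L {t} t∈X ex-t = subst (_≤ length (L t)) (trans (f-inX t∈X) (cong capacity ex-t)) (big t)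

      some-colour : ∀ t → f t ≡ 1 → ∃[ c ] c ∈ L t
      some-colour t f-t = nonempty (subst (_≤ length (L t)) f-t (big t))
        where
        nonempty : ∀ {cs : List ℕ} → 1 ≤ length cs → ∃[ c ] c ∈ cs
        nonempty {c ∷ _} _ = c , here refl

      cr : ℕ
      cr = proj₁ (some-colour r (f-exInf ex-r))

      cr∈ : cr ∈ L r
      cr∈ = proj₂ (some-colour r (f-exInf ex-r))

      cz : ℕ
      cz = proj₁ (some-colour z (f-notX z∉X))

      cz∈ : cz ∈ L z
      cz∈ = proj₂ (some-colour z (f-notX z∉X))

      two-avoiding-one : ∀ {t} → InX t → ex t ≡ ex1 → ∀ c → Two (λ m → m ∈ L t × m ≢ c)
      two-avoiding-one t∈X ex-t c = Two-map (λ (m∈ , m∉) → m∈ , m∉ ∘ here) (two-outside (c ∷ []) (unique _)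
        (≤-trans (+-monoˡ-≤ 2 (interSize≤length (c ∷ []) (unique _))) (length-L t∈X ex-t)))

      -- Colours available on P₁ once z has colour cz, and on P₂ once r and v have colours cr and c
      -- (w sees r and v besides its neighbour on P₂).
      Allowed₁ : V → ℕ → Set
      Allowed₁ t m = m ∈ L t × (t ≡ x ⊎ t ≡ y → m ≢ cz)

      Allowed₂ : ℕ → V → ℕ → Set
      Allowed₂ c t m = m ∈ L t × (t ≡ w → m ≢ cr × m ≢ c)

      open PathColouring Allowed₁
      module P₂ c = PathColouring (Allowed₂ c)
      module R₁ = Realisation Allowed₁
      module R₂ c = Realisation (Allowed₂ c)

      two-allowed₁ : ∀ {t} → t ∈ S₁ → t ≢ v → TwoAllowed t
      two-allowed₁ t∈ t≢v with S₁-kinds t∈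
      ... | _ , inj₁ t≡v = ⊥-elim (t≢v t≡v)
      ... | _ , inj₂ (inj₁ refl) = Two-map (λ (m∈ , m≢cz) → m∈ , λ _ → m≢cz) (two-avoiding-one x∈X ex-x cz)
      ... | _ , inj₂ (inj₂ (inj₁ refl)) = Two-map (λ (m∈ , m≢cz) → m∈ , λ _ → m≢cz) (two-avoiding-one y∈X ex-y cz)
      ... | t∈X , inj₂ (inj₂ (inj₂ ex-t)) =
            Two-map (λ m∈ → m∈ , ⊥-elim ∘ Sum.[ ex-≢ ex-t ex-x (λ ()) , ex-≢ ex-t ex-y (λ ()) ]′)
                    (two-elements (unique _) (length-L t∈X ex-t))

      two-A : All TwoAllowed A
      two-A = All.tabulate λ t∈ → two-allowed₁ (A⊆S₁ t∈) λ { refl → v∉A t∈ }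

      two-B : All TwoAllowed B
      two-B = All.tabulate λ t∈ → two-allowed₁ (B⊆S₁ t∈) λ { refl → v∉B t∈ }

      split₁ : ∀ p c c' → Escapes p c c' ⊎ Within p c c'
      split₁ p c c' with escapes-or-within (λ m → ((p ≟F x) ⊎-dec (p ≟F y)) →-dec ¬? (m ≟ cz)) (L p) c c'
      ... | inj₁ (m , m∈ , side , m≢c , m≢c') = inj₁ (m , (m∈ , side) , m≢c , m≢c')
      ... | inj₂ within = inj₂ λ m (m∈ , side) → within m m∈ side

      Candidate : ℕ → Set
      Candidate c = c ∈ L v × c ≢ cr × Two (λ d → d ∈ L w × d ≢ cr × d ≢ c)

      -- v has four colours and shares at most two with w: if cr ∈ L w, take colours of v outside L w.
      two-candidates : Two Candidate
      two-candidates with cr ∈? L w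
      ... | yes cr∈w = Two-map candidate (two-outside (L w) (unique v) bound)
        where
        bound : interSize (L v) (L w) + 2 ≤ length (L v)
        bound = ≤-trans (+-monoˡ-≤ 2 (smallMeet v w v-w)) (length-L v∈X ex-v)
        candidate : ∀ {c} → c ∈ L v × c ∉ L w → Candidate c
        candidate (c∈ , c∉) = c∈ , (λ { refl → c∉ cr∈w }) ,
          Two-map (λ (d∈ , d≢cr) → d∈ , d≢cr , λ { refl → c∉ d∈ }) (two-avoiding-one w∈X ex-w cr)
      ... | no cr∉w = Two-map candidate (two-outside (cr ∷ []) (unique v) bound)
        where
        bound : interSize (L v) (cr ∷ []) + 2 ≤ length (L v)
        bound = ≤-trans (+-monoˡ-≤ 2 (interSize≤length (cr ∷ []) (unique v))) (≤-trans (n≤1+n 3) (length-L v∈X ex-v))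
        candidate : ∀ {c} → c ∈ L v × c ∉ cr ∷ [] → Candidate c
        candidate {c} (c∈ , c∉) = c∈ , c∉ ∘ here ,
          Two-map (λ (d∈ , d≢c) → d∈ , (λ { refl → cr∉w d∈ }) , d≢c) (two-avoiding-one w∈X ex-w c)

      two-allowed₂ : ∀ {c} → Candidate c → ∀ {t} → t ∈ Q → P₂.TwoAllowed c t
      two-allowed₂ (_ , _ , two-w) t∈ with Q-kinds t∈
      ... | _ , inj₁ refl = Two-map (λ (m∈ , m≢cr , m≢c) → m∈ , λ _ → m≢cr , m≢c) two-w
      ... | t∈X , inj₂ ex-t = Two-map (λ m∈ → m∈ , λ { refl → ⊥-elim (ex-≢ ex-t ex-w (λ ()) refl) })
                                      (two-elements (unique _) (length-L t∈X ex-t))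

      Good : ℕ → Set
      Good c = ∃[ tx ] ∃[ ty ] tx ≢ ty × Extends c A tx × Extends c B ty

      good-from-A : ∀ {c} → Two (Extends c A) → Good c
      good-from-A {c} two with greedy two-B c
      ... | ty , eB with pick-avoiding two ty
      ...   | tx , eA , tx≢ty = tx , ty , tx≢ty , eA , eB

      good-from-B : ∀ {c} → Two (Extends c B) → Good c
      good-from-B {c} two with greedy two-A c
      ... | tx , eA with pick-avoiding two tx
      ...   | ty , eB , ty≢tx = tx , ty , ≢-sym ty≢tx , eA , eB

      palette-near-z : ∀ {q t s} → q ≡ x ⊎ q ≡ y → AllowsExactly q t s → L q ⊆ t ∷ s ∷ cz ∷ []
      palette-near-z q≡ (_ , _ , within) {m} m∈ with m ≟ cz
      ... | yes refl = there (there (here refl))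
      ... | no m≢cz with within m (m∈ , λ _ → m≢cz)
      ...   | inj₁ refl = here refl
      ...   | inj₂ refl = there (here refl)

      palette-near-z⊇ : ∀ {q t s} → InX q → ex q ≡ ex1 → q ≡ x ⊎ q ≡ y → AllowsExactly q t s → t ∷ s ∷ cz ∷ [] ⊆ L q
      palette-near-z⊇ q∈X ex-q q≡ exact = ⊆-pigeonhole (unique _) (palette-near-z q≡ exact) (length-L q∈X ex-q)

      -- L x and L y would both be {t, s, cz}.
      x-y-not-both-forced : ∀ {t s} → t ≢ s → AllowsExactly x t s → AllowsExactly y t s → ⊥
      x-y-not-both-forced {t} {s} t≢s exact-x@((_ , t≢cz) , (_ , s≢cz) , _) exact-y =
        n≮n 2 (≤-trans (Unique⇒length≤ t-s-cz-unique t-s-cz⊆L∩L) (smallMeet x y x-y))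
        where
        t-s-cz-unique : Unique (t ∷ s ∷ cz ∷ [])
        t-s-cz-unique = (t≢s ∷ t≢cz (inj₁ refl) ∷ []) ∷ (s≢cz (inj₁ refl) ∷ []) ∷ [] ∷ []
        t-s-cz⊆L∩L : t ∷ s ∷ cz ∷ [] ⊆ filter (_∈? L y) (L x)
        t-s-cz⊆L∩L m∈ = ∈-filter⁺ (_∈? L y) (palette-near-z⊇ x∈X ex-x (inj₁ refl) exact-x m∈)
                                             (palette-near-z⊇ y∈X ex-y (inj₂ refl) exact-y m∈)

      good-choice : ∀ {c c'} → c ≢ c' → Good c ⊎ Good c'
      good-choice c≢c' with dichotomy split₁ (u ∷ as) two-A c≢c' | dichotomy split₁ (reverse bs) two-B c≢c'
      ... | inj₁ two | _ = inj₁ (good-from-A two)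
      ... | inj₂ (inj₁ two) | _ = inj₂ (good-from-A two)
      ... | inj₂ (inj₂ _) | inj₁ two = inj₁ (good-from-B two)
      ... | inj₂ (inj₂ _) | inj₂ (inj₁ two) = inj₂ (good-from-B two)
      ... | inj₂ (inj₂ (tA , sA , tA≢sA , eA , eA' , exact-x)) | inj₂ (inj₂ (tB , sB , _ , eB , eB' , exact-y))
          with tA ≟ tB | sA ≟ sB
      ...   | no tA≢tB | _ = inj₁ (tA , tB , tA≢tB , eA , eB)
      ...   | yes _ | no sA≢sB = inj₂ (sA , sB , sA≢sB , eA' , eB')
      ...   | yes refl | yes refl = ⊥-elim (x-y-not-both-forced tA≢sA exact-x exact-y)

      module Assemble {c} (cand : Candidate c) {tx ty} (tx≢ty : tx ≢ ty) (eA : Extends c A tx) (eB : Extends c B ty) where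

        γ₀ : V → ℕ
        γ₀ = updateAt (updateAt (const c) r (const cr)) z (const cz)

        γ₀-v : γ₀ v ≡ c
        γ₀-v = trans (updateAt-minimal v z _ v≢z) (updateAt-minimal v r _ v≢r)

        module OnQ = R₂.Realises c
          (R₂.realise c {γ₀} γ₀-v v∉Q Q-unique (proj₂ (P₂.greedy c (All.tabulate (two-allowed₂ cand)) c)))
        module OnB = R₁.Realises (R₁.realise {OnQ.colouring} (trans (OnQ.unchanged v v∉Q) γ₀-v) v∉B B-unique eB)
        module OnA = R₁.Realises
          (R₁.realise {OnB.colouring} (trans (OnB.unchanged v v∉B) (trans (OnQ.unchanged v v∉Q) γ₀-v)) v∉A A-unique eA)

        φ : V → ℕ
        φ = OnA.colouring

        φ-B : ∀ {t} → t ∉ A → φ t ≡ OnB.colouring t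
        φ-B = OnA.unchanged _

        φ-Q : ∀ {t} → t ∉ A → t ∉ B → φ t ≡ OnQ.colouring t
        φ-Q t∉A t∉B = trans (φ-B t∉A) (OnB.unchanged _ t∉B)

        φ-γ₀ : ∀ {t} → t ∉ S₁ → t ∉ Q → φ t ≡ γ₀ t
        φ-γ₀ t∉S₁ t∉Q = trans (φ-Q (t∉S₁ ∘ A⊆S₁) (t∉S₁ ∘ B⊆S₁)) (OnQ.unchanged _ t∉Q)

        φ-v : φ v ≡ c
        φ-v = trans (φ-Q v∉A v∉B) (trans (OnQ.unchanged v v∉Q) γ₀-v)

        φ-r : φ r ≡ cr
        φ-r = trans (φ-γ₀ r∉S₁ r∉Q) (trans (updateAt-minimal r z _ (≢-sym z≢r)) (updateAt-updates r _))

        φ-z : φ z ≡ cz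
        φ-z = trans (φ-γ₀ z∉S₁ z∉Q) (updateAt-updates z _)

        φ-x : φ x ≡ tx
        φ-x = subst (λ q → φ q ≡ tx) (lastOf-∷ʳ v (u ∷ as) x) OnA.ends

        φ-y : φ y ≡ ty
        φ-y = trans (φ-B (B∉A (∈-++⁺ʳ (reverse bs) (here refl))))
                    (subst (λ q → OnB.colouring q ≡ ty) (lastOf-∷ʳ v (reverse bs) y) OnB.ends)

        allowed-A : ∀ {t} → t ∈ A → Allowed₁ t (φ t)
        allowed-A = All.lookup OnA.allowed

        allowed-B : ∀ {t} → t ∈ B → Allowed₁ t (φ t)
        allowed-B {t} t∈ = subst (Allowed₁ t) (sym (φ-B (B∉A t∈))) (All.lookup OnB.allowed t∈)

        allowed-Q : ∀ {t} → t ∈ Q → Allowed₂ c t (φ t)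
        allowed-Q {t} t∈ = subst (Allowed₂ c t) (sym (φ-Q (Q∉A t∈) (Q∉B t∈))) (All.lookup OnQ.allowed t∈)

        proper-Q : Linked (_≢_ on φ) (v ∷ Q)
        proper-Q = Linked-≗ (sym (φ-Q v∉A v∉B) ∷ All.tabulate λ t∈ → sym (φ-Q (Q∉A t∈) (Q∉B t∈))) OnQ.proper

        proper-Y : Linked (_≢_ on φ) Y
        proper-Y = subst (Linked (_≢_ on φ)) reverse-v∷B
          (Linked-reverse ≢-sym (Linked-≗ (sym (φ-B v∉A) ∷ All.tabulate λ t∈ → sym (φ-B (B∉A t∈))) OnB.proper))
          where
          reverse-v∷B : reverse (v ∷ B) ≡ Y
          reverse-v∷B = begin
            reverse (v ∷ B)                     ≡⟨ unfold-reverse v B ⟩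
            reverse (reverse bs ++ y ∷ []) ∷ʳ v ≡⟨ cong (_∷ʳ v) (reverse-++ (reverse bs) (y ∷ [])) ⟩
            (y ∷ reverse (reverse bs)) ∷ʳ v     ≡⟨ cong (λ l → (y ∷ l) ∷ʳ v) (reverse-involutive bs) ⟩
            Y                                   ∎

        proper-S₁ : Linked (_≢_ on φ) (v ∷ S₁)
        proper-S₁ = subst (λ l → Linked (_≢_ on φ) (v ∷ u ∷ l)) (sym (++-assoc as (x ∷ y ∷ bs) (v ∷ [])))
          (Linked-join (v ∷ u ∷ as) OnA.proper (λ eq → tx≢ty (trans (sym φ-x) (trans eq φ-y))) proper-Y)

        in-list : ∀ t → φ t ∈ L t
        in-list t with covers-vertices t
        ... | here refl = proj₁ (allowed-A (here refl))
        ... | there (here refl) = subst (_∈ L v) (sym φ-v) (proj₁ cand)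
        ... | there (there (here refl)) = proj₁ (allowed-Q (∈-++⁺ʳ cs (here refl)))
        ... | there (there (there (here refl))) = subst (_∈ L r) (sym φ-r) cr∈
        ... | there (there (there (there (here refl)))) = subst (_∈ L z) (sym φ-z) cz∈
        ... | there (there (there (there (there t∈)))) with ∈-++⁻ I₁ t∈
        ...   | inj₂ t∈cs = proj₁ (allowed-Q (∈-++⁺ˡ t∈cs))
        ...   | inj₁ t∈I₁ = Sum.[ proj₁ ∘ allowed-A , proj₁ ∘ allowed-B ]′ (I₁-split t∈I₁)

        w-not-cr-c : φ w ≢ cr × φ w ≢ c
        w-not-cr-c = proj₂ (allowed-Q (∈-++⁺ʳ cs (here refl))) refl

        proper : ∀ a b → Adj a b → φ a ≢ φ b
        proper a b a-b with covers-edges a b a-b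
        ... | inj₁ e = same-edge ≢-sym e λ eq → proj₂ w-not-cr-c (trans (sym eq) φ-v)
        ... | inj₂ (inj₁ e) = same-edge ≢-sym e λ eq → proj₁ w-not-cr-c (trans eq φ-r)
        ... | inj₂ (inj₂ (inj₁ e)) = same-edge ≢-sym e λ eq → proj₁ (proj₂ cand) (trans (sym φ-v) (trans eq φ-r))
        ... | inj₂ (inj₂ (inj₂ (inj₁ e))) = same-edge ≢-sym e (≢-sym (Linked.head proper-S₁))
        ... | inj₂ (inj₂ (inj₂ (inj₂ (inj₁ e)))) = linked-edge ≢-sym (Linked.tail proper-S₁) e
        ... | inj₂ (inj₂ (inj₂ (inj₂ (inj₂ (inj₁ e))))) =
              same-edge ≢-sym e λ eq → proj₂ (allowed-A (∈-++⁺ʳ (u ∷ as) (here refl))) (inj₁ refl) (trans (sym eq) φ-z)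
        ... | inj₂ (inj₂ (inj₂ (inj₂ (inj₂ (inj₂ (inj₁ e)))))) =
              same-edge ≢-sym e λ eq → proj₂ (allowed-B (∈-++⁺ʳ (reverse bs) (here refl))) (inj₂ refl) (trans (sym eq) φ-z)
        ... | inj₂ (inj₂ (inj₂ (inj₂ (inj₂ (inj₂ (inj₂ e)))))) = linked-edge ≢-sym proper-Q e

      L-colouring : ∃[ φ ] IsLColouring K L φ
      L-colouring with two-candidates
      ... | c , c' , c≢c' , cand , cand' with good-choice c≢c'
      ...   | inj₁ (tx , ty , tx≢ty , eA , eB) = let open Assemble cand tx≢ty eA eB in φ , in-list , proper
      ...   | inj₂ (tx , ty , tx≢ty , eA , eB) = let open Assemble cand' tx≢ty eA eB in φ , in-list , proper

lemma3p13 : (K : Configuration) → MatchesB2 K → Reducible K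
lemma3p13 K (_ , _ , _ , _ , _ , _ , _ , _ , _ , _ , matches) L isF = Template.Colouring.L-colouring K (matches⇒B2 K matches) L isF
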